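{- Let $F$ be a clause-set with all clauses of length $1$ or $2$, and let $\{x\},\{y\} \in F$ be two different unit-clauses. Then the map $P \mapsto F(P) := \mathcal{CL}(E(P)) \cup \{\{x\},\{y\}\}$ is a bijection from the set $\mathfrak R_{x,\overline y}(\mathrm{idg}(F))$ of regular paths from $x$ to $\overline y$ in $\mathrm{idg}(F)$ onto the set of minimally unsatisfiable subsets of $F$ containing both $\{x\}$ and $\{y\}$.
   Context: Literals are variables and complements ($\overline{\overline x}=x$); a clause is a finite set of literals without complementary pair; $F$ is a finite set of clauses. A clause-set is minimally unsatisfiable if unsatisfiable and every proper subset obtained by removing one clause is satisfiable. The implication digraph $\mathrm{idg}(F)$ has as vertices all literals whose variable occurs in $F$; for each binary clause $\{a,b\}\in F$ it has arcs $(\overline a,b)$ and $(\overline b,a)$, and for each unit-clause $\{a\}$ the arc $(\overline a, a)$. For a set $A$ of arcs, $\mathcal{CL}(A)=\{\{\overline a,b\} : (a,b)\in A\}$ (so an arc $(\overline a,a)$ gives the unit-clause $\{a\}$). A path is a directed path with pairwise distinct vertices (considered as a subdigraph); it is regular if its vertex set contains no pair of complementary literals. -}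

module Defs where

open import Data.Nat using (ℕ)
open import Data.Bool using (Bool; true; false; not)
open import Data.List using (List; []; _∷_; length)
open import Data.List.Membership.Propositional using (_∈_; _∉_)
open import Data.List.Relation.Unary.Any using (Any)
open import Data.List.Relation.Unary.All using (All)
open import Data.List.Relation.Unary.Unique.Propositional using (Unique)
open import Data.List.Relation.Binary.Subset.Propositional using (_⊆_)
open import Data.Vec using (Vec; lookup)
open import Data.Fin using (Fin)
open import Data.Product using (Σ; ∃; ∃-syntax; _×_)
open import Data.Sum using (_⊎_)
open import Relation.Binary.PropositionalEquality using (_≡_; _≢_)
open import Relation.Nullary using (¬_)

data Lit : Set where
  pos : ℕ → Lit
  neg : ℕ → Lit

compl : Lit → Lit
compl (pos v) = neg v
compl (neg v) = pos v

-- A clause is a finite set of literals, represented by a duplicate-free list.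
Clause : Set
Clause = List Lit

_≈ᶜ_ : Clause → Clause → Set
C ≈ᶜ D = (C ⊆ D) × (D ⊆ C)

WFClause : Clause → Set
WFClause C = Unique C × (∀ a → a ∈ C → compl a ∉ C)

-- A clause-set with n clauses: the clauses are well-formed and pairwise
-- different as sets (so F is a genuine set of clauses, indexed by Fin n).
WFClauseSet : ∀ {n} → Vec Clause n → Set
WFClauseSet {n} F =
  (∀ i → WFClause (lookup F i)) × (∀ i j → lookup F i ≈ᶜ lookup F j → i ≡ j)

-- Sub-clause-sets of F are given by predicates on indices.
SubCS : ℕ → Set₁
SubCS n = Fin n → Set

Assignment : Set
Assignment = ℕ → Bool

evalLit : Assignment → Lit → Bool
evalLit φ (pos v) = φ v
evalLit φ (neg v) = not (φ v)

SatClause : Assignment → Clause → Set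
SatClause φ C = Any (λ l → evalLit φ l ≡ true) C

Satisfiable : ∀ {n} → Vec Clause n → SubCS n → Set
Satisfiable F G = ∃[ φ ] (∀ i → G i → SatClause φ (lookup F i))

MinUnsat : ∀ {n} → Vec Clause n → SubCS n → Set
MinUnsat F G =
  ¬ Satisfiable F G ×
  (∀ i → G i → Satisfiable F (λ j → G j × j ≢ i))

data Arc {n} (F : Vec Clause n) : Lit → Lit → Set where
  bin₁ : ∀ i a b → lookup F i ≡ a ∷ b ∷ [] → Arc F (compl a) b
  bin₂ : ∀ i a b → lookup F i ≡ a ∷ b ∷ [] → Arc F (compl b) a
  unit : ∀ i a → lookup F i ≡ a ∷ [] → Arc F (compl a) a

data Walk {n} (F : Vec Clause n) : Lit → Lit → List Lit → Set where
  here : ∀ a → Walk F a a (a ∷ [])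
  step : ∀ {a c b vs} → Arc F a c → Walk F c b vs → Walk F a b (a ∷ vs)

RegPath : ∀ {n} → Vec Clause n → Lit → Lit → List Lit → Set
RegPath F a b vs =
  Walk F a b vs × Unique vs × (∀ u → u ∈ vs → compl u ∉ vs)

data Consec : List Lit → Lit → Lit → Set where
  here  : ∀ {a b vs} → Consec (a ∷ b ∷ vs) a b
  there : ∀ {c a b vs} → Consec vs a b → Consec (c ∷ vs) a b

CLarc : Lit → Lit → Clause
CLarc a b = compl a ∷ b ∷ []

FP : ∀ {n} → Vec Clause n → Lit → Lit → List Lit → SubCS n
FP F x y vs i =
  (lookup F i ≈ᶜ (x ∷ [])) ⊎ (lookup F i ≈ᶜ (y ∷ [])) ⊎
  (∃[ a ] ∃[ b ] (Consec vs a b × lookup F i ≈ᶜ CLarc a b))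

-- Along a walk x → … → ȳ of idg(F) every arc clause {ā, b} propagates truth from a to b, so
-- {x}, {y} and the arc clauses of a path P are contradictory. If P is regular, cutting it just
-- before the removed clause and setting the first part true and the rest false satisfies all
-- other clauses, so F(P) is minimally unsatisfiable; and P can be read back from F(P), since
-- regularity fixes the orientation of every arc clause.
--
-- Conversely, let S be minimally unsatisfiable with {x}, {y} ∈ S. An assignment of S ∖ {y}
-- makes every literal reachable from x in idg(S) true, as long as ȳ is not reached. If ȳ
-- were not reachable, the reachable literals would therefore be consistent, and setting them
-- true while following an assignment of S ∖ {x} elsewhere would satisfy S. So there is a
-- walk from x to ȳ; shortcut to a path P, its vertices are all true under that assignment,
-- so P is regular, and F(P) ⊆ S is unsatisfiable, hence equal to S by minimality.

module Submission where

open import Defs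
open import Data.Nat using (zero; suc; _≤_; z≤n; s≤s)
open import Data.Nat.Properties using (_≟_)
open import Data.Bool using (true; false; not; _∨_)
open import Data.Bool.Properties using (not-involutive)
open import Data.List using (List; []; _∷_; length; _++_)
open import Data.List.Properties using (++-assoc; ++-identityʳ; length-++-sucʳ; ∷-injectiveˡ)
open import Data.List.Membership.Propositional using (find; lose)
  renaming (_∈_ to _∈ˡ_; _∉_ to _∉ˡ_)
open import Data.List.Membership.Propositional.Properties
  using (∈-++⁺ˡ; ∈-++⁺ʳ; ∈-++⁻; ∈-∃++)
open import Data.List.Relation.Unary.Any using (Any; here; there)
import Data.List.Relation.Unary.Any as Any
open import Data.List.Relation.Unary.Any.Properties using (singleton⁻)
open import Data.List.Relation.Unary.All using (All; []; _∷_)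
import Data.List.Relation.Unary.All as All
open import Data.List.Relation.Unary.All.Properties using (¬Any⇒All¬)
open import Data.List.Relation.Unary.AllPairs using ([]; _∷_)
open import Data.List.Relation.Unary.Unique.Propositional using (Unique)
open import Data.List.Relation.Binary.Subset.Propositional using (_⊆_)
open import Data.Vec using (Vec; lookup)
import Data.Vec as Vec
open import Data.Fin using (Fin)
open import Data.Fin.Subset using (Subset; _∈_)
open import Data.Fin.Subset.Properties using (_∈?_)
open import Data.Fin.Properties using (any?) renaming (_≟_ to _≟ᶠ_)
open import Data.Product using (_×_; ∃-syntax; Σ; _,_; proj₁; proj₂)
open import Data.Sum using (_⊎_; inj₁; inj₂)
open import Data.Empty using (⊥; ⊥-elim)
open import Function.Base using (_∘_)
open import Function.Bundles using (_⇔_; mk⇔; Equivalence)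
open import Relation.Binary.Definitions using (DecidableEquality)
open import Relation.Binary.PropositionalEquality
  using (_≡_; _≢_; refl; sym; trans; cong; subst)
open import Relation.Nullary using (¬_; Dec; yes; no)
open import Relation.Nullary.Decidable using (⌊_⌋; map′; _×-dec_; _⊎-dec_)

_≟ᴸ_ : DecidableEquality Lit
pos u ≟ᴸ pos v = map′ (cong pos) (λ { refl → refl }) (u ≟ v)
pos u ≟ᴸ neg v = no λ ()
neg u ≟ᴸ pos v = no λ ()
neg u ≟ᴸ neg v = map′ (cong neg) (λ { refl → refl }) (u ≟ v)

open import Data.List.Membership.DecPropositional _≟ᴸ_ using () renaming (_∈?_ to _∈ˡ?_)
open import Data.List.Relation.Binary.Subset.DecPropositional _≟ᴸ_ using (_⊆?_)

compl-involutive : ∀ a → compl (compl a) ≡ a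
compl-involutive (pos v) = refl
compl-involutive (neg v) = refl

compl-injective : ∀ {a b} → compl a ≡ compl b → a ≡ b
compl-injective {a} {b} eq =
  trans (sym (compl-involutive a)) (trans (cong compl eq) (compl-involutive b))

evalLit-compl : ∀ φ a → evalLit φ (compl a) ≡ not (evalLit φ a)
evalLit-compl φ (pos v) = refl
evalLit-compl φ (neg v) = sym (not-involutive (φ v))

true-and-compl-true⇒⊥ : ∀ φ a → evalLit φ a ≡ true → evalLit φ (compl a) ≡ true → ⊥
true-and-compl-true⇒⊥ φ a p q with trans (sym (evalLit-compl φ a)) q
... | r rewrite p with r
... | ()

false⇒compl-true : ∀ φ a → evalLit φ a ≡ false → evalLit φ (compl a) ≡ true
false⇒compl-true φ a p = trans (evalLit-compl φ a) (cong not p)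

compl-false⇒true : ∀ φ a → evalLit φ (compl a) ≡ false → evalLit φ a ≡ true
compl-false⇒true φ a p =
  subst (λ b → evalLit φ b ≡ true) (compl-involutive a) (false⇒compl-true φ (compl a) p)

≈ᶜ-refl : ∀ {C} → C ≈ᶜ C
≈ᶜ-refl = (λ m → m) , (λ m → m)

≈ᶜ-sym : ∀ {C D} → C ≈ᶜ D → D ≈ᶜ C
≈ᶜ-sym (C⊆D , D⊆C) = D⊆C , C⊆D

≈ᶜ-trans : ∀ {C D E} → C ≈ᶜ D → D ≈ᶜ E → C ≈ᶜ E
≈ᶜ-trans (C⊆D , D⊆C) (D⊆E , E⊆D) = (λ m → D⊆E (C⊆D m)) , (λ m → D⊆C (E⊆D m))

≡⇒≈ᶜ : ∀ {C D} → C ≡ D → C ≈ᶜ D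
≡⇒≈ᶜ refl = ≈ᶜ-refl

_≈ᶜ?_ : (C D : Clause) → Dec (C ≈ᶜ D)
C ≈ᶜ? D = (C ⊆? D) ×-dec (D ⊆? C)

pair-comm : ∀ {a b} → (a ∷ b ∷ []) ≈ᶜ (b ∷ a ∷ [])
pair-comm = swap , swap
  where
  swap : ∀ {a b c} → c ∈ˡ a ∷ b ∷ [] → c ∈ˡ b ∷ a ∷ []
  swap (here eq) = there (here eq)
  swap (there (here eq)) = here eq

unit≈pair : ∀ {a} → (a ∷ []) ≈ᶜ (a ∷ a ∷ [])
unit≈pair = there , λ { (here eq) → here eq ; (there m) → m }

satClause-unit : ∀ {φ a} → SatClause φ (a ∷ []) → evalLit φ a ≡ true
satClause-unit = singleton⁻

satClause-agree : ∀ {φ ψ C} → (∀ {l} → l ∈ˡ C → evalLit ψ l ≡ evalLit φ l) →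
  SatClause φ C → SatClause ψ C
satClause-agree agree s with find s
... | _ , m , l-true = lose m (trans (agree m) l-true)

satClause-⊆-CLarc : ∀ {φ C a b} → SatClause φ C → C ⊆ CLarc a b →
  evalLit φ a ≡ true → evalLit φ b ≡ true
satClause-⊆-CLarc {φ} {a = a} s C⊆ab a-true with find s
... | _ , m , l-true with C⊆ab m
...   | here refl = ⊥-elim (true-and-compl-true⇒⊥ φ a a-true l-true)
...   | there (here refl) = l-true

CLarc≈CLarc : ∀ {a b c d} → CLarc a b ≈ᶜ CLarc c d → b ≢ compl a →
  (a ≡ c × b ≡ d) ⊎ (d ≡ compl a × c ≡ compl b)
CLarc≈CLarc {a} {b} {c} {d} (ab⊆cd , _) b≢ā
  with ab⊆cd (here refl) | ab⊆cd (there (here refl))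
... | here p         | here q         = ⊥-elim (b≢ā (trans q (sym p)))
... | here p         | there (here q) = inj₁ (compl-injective p , q)
... | there (here p) | here q         =
  inj₂ (sym p , trans (sym (compl-involutive c)) (cong compl (sym q)))
... | there (here p) | there (here q) = ⊥-elim (b≢ā (trans q (sym p)))

CLarc≈unit : ∀ {a b z} → CLarc a b ≈ᶜ (z ∷ []) → b ≡ compl a
CLarc≈unit (ab⊆z , _) with ab⊆z (here refl) | ab⊆z (there (here refl))
... | here p | here q = trans q (sym p)

_─_ : ∀ {n} → SubCS n → Fin n → SubCS n
(G ─ i) j = G j × j ≢ i

minUnsat-⊇-unsat : ∀ {n} {F : Vec Clause n} {G H : SubCS n} → MinUnsat F G →
  (∀ i → H i → G i) → ¬ Satisfiable F H → (∀ i → Dec (H i)) → ∀ i → G i → H i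
minUnsat-⊇-unsat (_ , G─i-sat) H⊆G H-unsat H? i g with H? i
... | yes h = h
... | no ¬h with G─i-sat i g
...   | φ , sat = ⊥-elim (H-unsat (φ , λ j h → sat j (H⊆G j h , λ { refl → ¬h h })))

Regular : List Lit → Set
Regular vs = ∀ u → u ∈ˡ vs → compl u ∉ˡ vs

Consistent : (Lit → Set) → Set
Consistent R = ∀ l → R l → R (compl l) → ⊥

regular-tail : ∀ {a vs} → Regular (a ∷ vs) → Regular vs
regular-tail reg u m c = reg u (there m) (there c)

consec-∈ˡ : ∀ {vs a b} → Consec vs a b → a ∈ˡ vs
consec-∈ˡ here = here refl
consec-∈ˡ (there c) = there (consec-∈ˡ c)

consec-∈ʳ : ∀ {vs a b} → Consec vs a b → b ∈ˡ vs
consec-∈ʳ here = there (here refl)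
consec-∈ʳ (there c) = there (consec-∈ʳ c)

regular-consec : ∀ {vs a b} → Regular vs → Consec vs a b → b ≢ compl a
regular-consec reg ab b≡ā = reg _ (consec-∈ˡ ab) (subst (_∈ˡ _) b≡ā (consec-∈ʳ ab))

consec-split : ∀ {vs a b} → Consec vs a b → ∃[ pre ] ∃[ post ] (vs ≡ pre ++ a ∷ b ∷ post)
consec-split here = [] , _ , refl
consec-split (there {c} h) with consec-split h
... | pre , post , eq = c ∷ pre , post , cong (c ∷_) eq

consec-++ : ∀ pre {a b post c d} → Consec (pre ++ a ∷ b ∷ post) c d →
  (c ≡ a × d ≡ b) ⊎ (d ∈ˡ pre ++ a ∷ []) ⊎ (c ∈ˡ b ∷ post)
consec-++ [] here = inj₁ (refl , refl)
consec-++ [] (there h) = inj₂ (inj₂ (consec-∈ˡ h))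
consec-++ (p ∷ []) here = inj₂ (inj₁ (there (here refl)))
consec-++ (p ∷ q ∷ pre) here = inj₂ (inj₁ (there (here refl)))
consec-++ (p ∷ pre) (there h) with consec-++ pre h
... | inj₁ eqs = inj₁ eqs
... | inj₂ (inj₁ m) = inj₂ (inj₁ (there m))
... | inj₂ (inj₂ m) = inj₂ (inj₂ m)

consec-head-unique : ∀ {s c vs} → Unique (s ∷ vs) → Consec (s ∷ vs) s c → ∃[ vs′ ] vs ≡ c ∷ vs′
consec-head-unique _ here = _ , refl
consec-head-unique (s∉ ∷ _) (there sc) = ⊥-elim (All.lookup s∉ (consec-∈ˡ sc) refl)

consecPair? : ∀ {R : Lit → Lit → Set} → (∀ a b → Dec (R a b)) →
  ∀ vs → Dec (∃[ a ] ∃[ b ] (Consec vs a b × R a b))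
consecPair? R? [] = no λ { (_ , _ , () , _) }
consecPair? R? (_ ∷ []) = no λ { (_ , _ , there () , _) }
consecPair? R? (a ∷ b ∷ vs) with R? a b | consecPair? R? (b ∷ vs)
... | yes r | _ = yes (a , b , here , r)
... | no _ | yes (c , d , cd , r) = yes (c , d , there cd , r)
... | no ¬r | no ¬rest = no λ
  { (_ , _ , here , r) → ¬r r
  ; (c , d , there cd , r) → ¬rest (c , d , cd , r) }

ArcClauses⊆ : List Lit → List Lit → Set
ArcClauses⊆ P Q = ∀ {a b} → Consec P a b → ∃[ c ] ∃[ d ] (Consec Q c d × CLarc a b ≈ᶜ CLarc c d)

-- The clause {ā, b} is also the arc (b̄, ā); regularity of Q excludes that reading.
ArcClauses⊆-consec : ∀ {P Q a b} → Regular P → Regular Q → a ∈ˡ Q → ArcClauses⊆ P Q →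
  Consec P a b → Consec Q a b
ArcClauses⊆-consec regP regQ a∈Q H ab with H ab
... | c , d , cd , ab≈cd with CLarc≈CLarc ab≈cd (regular-consec regP ab)
...   | inj₁ (refl , refl) = cd
...   | inj₂ (refl , _) = ⊥-elim (regQ _ a∈Q (consec-∈ʳ cd))

ArcClauses⊆-tail : ∀ {s P Q} → Unique (s ∷ P) → Regular (s ∷ P) →
  ArcClauses⊆ (s ∷ P) (s ∷ Q) → ArcClauses⊆ P Q
ArcClauses⊆-tail (s∉ ∷ _) reg H ab with H (there ab)
... | c , d , there cd , ab≈cd = c , d , cd , ab≈cd
... | c , d , here , ab≈cd with CLarc≈CLarc ab≈cd (regular-consec reg (there ab))
...   | inj₁ (refl , _) = ⊥-elim (All.lookup s∉ (consec-∈ˡ ab) refl)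
...   | inj₂ (_ , refl) = ⊥-elim (reg _ (there (consec-∈ʳ ab)) (here refl))

unique-++-disjoint : ∀ xs {ys : List Lit} {u} → Unique (xs ++ ys) → u ∈ˡ xs → u ∉ˡ ys
unique-++-disjoint (x ∷ xs) (x∉ ∷ _) (here refl) m = All.lookup x∉ (∈-++⁺ʳ xs m) refl
unique-++-disjoint (x ∷ xs) (_ ∷ u) (there m) = unique-++-disjoint xs u m

unique-length-≤ : ∀ (xs ys : List Lit) → Unique xs → xs ⊆ ys → length xs ≤ length ys
unique-length-≤ [] ys _ _ = z≤n
unique-length-≤ (x ∷ xs) ys (x∉ ∷ u) xs⊆ys with ∈-∃++ (xs⊆ys (here refl))
... | ys₁ , ys₂ , refl =
  subst (suc (length xs) ≤_) (sym (length-++-sucʳ ys₁ x ys₂))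
    (s≤s (unique-length-≤ xs (ys₁ ++ ys₂) u xs⊆ys₁ys₂))
  where
  xs⊆ys₁ys₂ : xs ⊆ ys₁ ++ ys₂
  xs⊆ys₁ys₂ m with ∈-++⁻ ys₁ (xs⊆ys (there m))
  ... | inj₁ m₁ = ∈-++⁺ˡ m₁
  ... | inj₂ (here refl) = ⊥-elim (All.lookup x∉ m refl)
  ... | inj₂ (there m₂) = ∈-++⁺ʳ ys₁ m₂

cut : List Lit → List Lit → Assignment
cut T Fl v = ⌊ pos v ∈ˡ? T ⌋ ∨ ⌊ neg v ∈ˡ? Fl ⌋

cut-true : ∀ T Fl u → u ∈ˡ T → compl u ∉ˡ T → u ∉ˡ Fl → evalLit (cut T Fl) u ≡ true
cut-true T Fl (pos v) u∈T _ _ with pos v ∈ˡ? T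
... | yes _ = refl
... | no u∉T = ⊥-elim (u∉T u∈T)
cut-true T Fl (neg v) _ ū∉T u∉Fl with pos v ∈ˡ? T | neg v ∈ˡ? Fl
... | yes ū∈T | _ = ⊥-elim (ū∉T ū∈T)
... | no _ | yes u∈Fl = ⊥-elim (u∉Fl u∈Fl)
... | no _ | no _ = refl

cut-false : ∀ T Fl u → u ∈ˡ Fl → compl u ∉ˡ Fl → u ∉ˡ T → evalLit (cut T Fl) u ≡ false
cut-false T Fl (pos v) _ ū∉Fl u∉T with pos v ∈ˡ? T | neg v ∈ˡ? Fl
... | yes u∈T | _ = ⊥-elim (u∉T u∈T)
... | no _ | yes ū∈Fl = ⊥-elim (ū∉Fl ū∈Fl)
... | no _ | no _ = refl
cut-false T Fl (neg v) u∈Fl _ _ with pos v ∈ˡ? T | neg v ∈ˡ? Fl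
... | yes _ | _ = refl
... | no _ | yes _ = refl
... | no _ | no u∉Fl = ⊥-elim (u∉Fl u∈Fl)

module _ {T Fl P : List Lit} (split : T ++ Fl ≡ P) (unique : Unique P) (regular : Regular P) where

  private
    T⊆P : T ⊆ P
    T⊆P m = subst (_ ∈ˡ_) split (∈-++⁺ˡ m)

    Fl⊆P : Fl ⊆ P
    Fl⊆P m = subst (_ ∈ˡ_) split (∈-++⁺ʳ T m)

    T∩Fl≡∅ : ∀ {u} → u ∈ˡ T → u ∉ˡ Fl
    T∩Fl≡∅ = unique-++-disjoint T (subst Unique (sym split) unique)

  cut-true-on-T : ∀ {u} → u ∈ˡ T → evalLit (cut T Fl) u ≡ true
  cut-true-on-T {u} m = cut-true T Fl u m (λ c → regular u (T⊆P m) (T⊆P c)) (T∩Fl≡∅ m)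

  cut-false-on-Fl : ∀ {u} → u ∈ˡ Fl → evalLit (cut T Fl) u ≡ false
  cut-false-on-Fl {u} m =
    cut-false T Fl u m (λ c → regular u (Fl⊆P m) (Fl⊆P c)) (λ m′ → T∩Fl≡∅ m′ m)

literals : ∀ {n} → Vec Clause n → List Lit
literals Vec.[] = []
literals (C Vec.∷ F) = C ++ literals F

lookup⊆literals : ∀ {n} (F : Vec Clause n) i → lookup F i ⊆ literals F
lookup⊆literals (C Vec.∷ F) Fin.zero m = ∈-++⁺ˡ m
lookup⊆literals (C Vec.∷ F) (Fin.suc i) m = ∈-++⁺ʳ C (lookup⊆literals F i m)

onlyIf : ∀ {A : Set} → Dec A → Lit → List Lit
onlyIf (yes _) c = c ∷ []
onlyIf (no _) _ = []

∈-onlyIf : ∀ {A : Set} (A? : Dec A) {c v} → v ∈ˡ onlyIf A? c → A × v ≡ c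
∈-onlyIf (yes a) (here eq) = a , eq

onlyIf-refl : ∀ a c → c ∈ˡ onlyIf (a ≟ᴸ a) c
onlyIf-refl a c with a ≟ᴸ a
... | yes _ = here refl
... | no a≢a = ⊥-elim (a≢a refl)

successors : Lit → Clause → List Lit
successors a (p ∷ []) = onlyIf (a ≟ᴸ compl p) p
successors a (p ∷ q ∷ []) = onlyIf (a ≟ᴸ compl p) q ++ onlyIf (a ≟ᴸ compl q) p
successors a _ = []

module _ {n} (F : Vec Clause n) where

  clauseOf : ∀ {a b} → Arc F a b → Fin n
  clauseOf (bin₁ i _ _ _) = i
  clauseOf (bin₂ i _ _ _) = i
  clauseOf (unit i _ _) = i

  clauseOf-≈ : ∀ {a b} (e : Arc F a b) → lookup F (clauseOf e) ≈ᶜ CLarc a b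
  clauseOf-≈ (bin₁ i a b eq) =
    subst (λ c → lookup F i ≈ᶜ (c ∷ b ∷ [])) (sym (compl-involutive a)) (≡⇒≈ᶜ eq)
  clauseOf-≈ (bin₂ i a b eq) =
    subst (λ c → lookup F i ≈ᶜ (c ∷ a ∷ [])) (sym (compl-involutive b))
      (≈ᶜ-trans (≡⇒≈ᶜ eq) pair-comm)
  clauseOf-≈ (unit i a eq) =
    subst (λ c → lookup F i ≈ᶜ (c ∷ a ∷ [])) (sym (compl-involutive a))
      (≈ᶜ-trans (≡⇒≈ᶜ eq) unit≈pair)

  arc-propagates : ∀ {φ a b} (e : Arc F a b) → SatClause φ (lookup F (clauseOf e)) →
    evalLit φ a ≡ true → evalLit φ b ≡ true
  arc-propagates e s = satClause-⊆-CLarc s (proj₁ (clauseOf-≈ e))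

  unit-arc-source : ∀ {a b z} (e : Arc F a b) → lookup F (clauseOf e) ≡ z ∷ [] → a ≡ compl z
  unit-arc-source {a} e eq with subst (compl a ∈ˡ_) eq (proj₂ (clauseOf-≈ e) (here refl))
  ... | here ā≡z = trans (sym (compl-involutive a)) (cong compl ā≡z)

  walk-head : ∀ {s t v vs} → Walk F s t (v ∷ vs) → s ≡ v
  walk-head (here _) = refl
  walk-head (step _ _) = refl

  walk-start-∈ : ∀ {s t vs} → Walk F s t vs → s ∈ˡ vs
  walk-start-∈ (here _) = here refl
  walk-start-∈ (step _ _) = here refl

  walk-end-∈ : ∀ {s t vs} → Walk F s t vs → t ∈ˡ vs
  walk-end-∈ (here _) = here refl
  walk-end-∈ (step _ w) = there (walk-end-∈ w)

  walk-start-∈-++ : ∀ pre {s t a vs} → Walk F s t (pre ++ a ∷ vs) → s ∈ˡ pre ++ a ∷ []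
  walk-start-∈-++ [] w = here (walk-head w)
  walk-start-∈-++ (_ ∷ _) w = here (walk-head w)

  walk-end-∈-++ : ∀ pre {s t a vs} → Walk F s t (pre ++ a ∷ vs) → t ∈ˡ a ∷ vs
  walk-end-∈-++ [] w = walk-end-∈ w
  walk-end-∈-++ (_ ∷ []) (step _ w) = walk-end-∈ w
  walk-end-∈-++ (_ ∷ p ∷ pre) (step _ w) = walk-end-∈-++ (p ∷ pre) w

  consec-head : ∀ {s c t vs} → Walk F c t vs → Consec (s ∷ vs) s c
  consec-head (here _) = here
  consec-head (step _ _) = here

  data WalkIn (G : SubCS n) : Lit → Lit → List Lit → Set where
    here : ∀ a → WalkIn G a a (a ∷ [])
    step : ∀ {a c b vs} (e : Arc F a c) → G (clauseOf e) → WalkIn G c b vs →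
      WalkIn G a b (a ∷ vs)

  Reachable : SubCS n → Lit → Lit → Set
  Reachable G a b = ∃[ vs ] WalkIn G a b vs

  toWalk : ∀ {G a b vs} → WalkIn G a b vs → Walk F a b vs
  toWalk (here a) = here a
  toWalk (step e _ w) = step e (toWalk w)

  walkIn-mono : ∀ {G H : SubCS n} → (∀ i → G i → H i) →
    ∀ {a b vs} → WalkIn G a b vs → WalkIn H a b vs
  walkIn-mono G⊆H (here a) = here a
  walkIn-mono G⊆H (step e g w) = step e (G⊆H _ g) (walkIn-mono G⊆H w)

  walkIn-consec-arc : ∀ {G s t vs a b} → WalkIn G s t vs → Consec vs a b →
    Σ (Arc F a b) (λ e → G (clauseOf e))
  walkIn-consec-arc (step e g (here _)) here = e , g
  walkIn-consec-arc (step e g (step _ _ _)) here = e , g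
  walkIn-consec-arc (step _ _ w) (there cd) = walkIn-consec-arc w cd

  walkIn-true : ∀ {G φ} → (∀ i → G i → SatClause φ (lookup F i)) →
    ∀ {a b vs} → WalkIn G a b vs → evalLit φ a ≡ true → All (λ u → evalLit φ u ≡ true) vs
  walkIn-true sat (here a) a-true = a-true ∷ []
  walkIn-true sat (step e g w) a-true =
    a-true ∷ walkIn-true sat w (arc-propagates e (sat _ g) a-true)

  walkIn-snoc : ∀ {G a b c vs} → WalkIn G a b vs → (e : Arc F b c) → G (clauseOf e) →
    Reachable G a c
  walkIn-snoc (here _) e g = _ , step e g (here _)
  walkIn-snoc (step e′ g′ w) e g with walkIn-snoc w e g
  ... | _ , w′ = _ , step e′ g′ w′

  walkIn-suffix : ∀ {G a c t ws} → WalkIn G c t ws → Unique ws → a ∈ˡ ws →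
    ∃[ ws′ ] (WalkIn G a t ws′ × Unique ws′)
  walkIn-suffix w@(here _) u (here refl) = _ , w , u
  walkIn-suffix w@(step _ _ _) u (here refl) = _ , w , u
  walkIn-suffix (step _ _ w) (_ ∷ u) (there m) = walkIn-suffix w u m

  shortcut : ∀ {G a t vs} → WalkIn G a t vs → ∃[ ws ] (WalkIn G a t ws × Unique ws)
  shortcut (here a) = _ , here a , [] ∷ []
  shortcut {a = a} (step e g w) with shortcut w
  ... | ws , w′ , u with a ∈ˡ? ws
  ...   | yes a∈ws = walkIn-suffix w′ u a∈ws
  ...   | no a∉ws = _ , step e g w′ , ¬Any⇒All¬ ws a∉ws ∷ u

  -- The only arc of a unit clause {z} leaves z̄, so walks not passing through z̄ avoid it.

  walkIn-avoid-unit : ∀ {G k z a b vs} → lookup F k ≡ z ∷ [] → WalkIn G a b vs →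
    WalkIn (G ─ k) a b vs ⊎ Reachable G a (compl z)
  walkIn-avoid-unit Fk (here a) = inj₁ (here a)
  walkIn-avoid-unit {G} {k} {z} Fk (step e g w) with clauseOf e ≟ᶠ k
  ... | yes refl = inj₂ (_ , subst (λ a → WalkIn G a (compl z) (a ∷ []))
                               (sym (unit-arc-source e Fk)) (here _))
  ... | no e↛k with walkIn-avoid-unit Fk w
  ...   | inj₁ w′ = inj₁ (step e (g , e↛k) w′)
  ...   | inj₂ (_ , w′) = inj₂ (_ , step e g w′)

  unique-walkIn-avoid-unit : ∀ {G k z a vs} → lookup F k ≡ z ∷ [] →
    WalkIn G a (compl z) vs → Unique vs → WalkIn (G ─ k) a (compl z) vs
  unique-walkIn-avoid-unit Fk (here a) _ = here a
  unique-walkIn-avoid-unit {k = k} Fk (step e g w) (a∉ ∷ u) with clauseOf e ≟ᶠ k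
  ... | yes refl = ⊥-elim (All.lookup a∉ (walk-end-∈ (toWalk w)) (unit-arc-source e Fk))
  ... | no e↛k = step e (g , e↛k) (unique-walkIn-avoid-unit Fk w u)

  ArcClause : List Lit → SubCS n
  ArcClause vs i = ∃[ a ] ∃[ b ] (Consec vs a b × lookup F i ≈ᶜ CLarc a b)

  walk-uses-ArcClause : ∀ {a b vs} → Walk F a b vs → WalkIn (ArcClause vs) a b vs
  walk-uses-ArcClause (here a) = here a
  walk-uses-ArcClause (step e w) =
    step e (_ , _ , consec-head w , clauseOf-≈ e)
      (walkIn-mono (λ { _ (c , d , cd , eq) → c , d , there cd , eq }) (walk-uses-ArcClause w))

  FP? : ∀ x y P i → Dec (FP F x y P i)
  FP? x y P i = (lookup F i ≈ᶜ? (x ∷ [])) ⊎-dec ((lookup F i ≈ᶜ? (y ∷ []))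
    ⊎-dec consecPair? (λ a b → lookup F i ≈ᶜ? CLarc a b) P)

  FP-unsat : ∀ {x y ix iy P} → lookup F ix ≡ x ∷ [] → lookup F iy ≡ y ∷ [] →
    Walk F x (compl y) P → ¬ Satisfiable F (FP F x y P)
  FP-unsat {x} {y} {ix} {iy} Fix Fiy w (φ , sat) =
    true-and-compl-true⇒⊥ φ y y-true (All.lookup P-true (walk-end-∈ w))
    where
    x-true : evalLit φ x ≡ true
    x-true = satClause-unit (subst (SatClause φ) Fix (sat ix (inj₁ (≡⇒≈ᶜ Fix))))
    y-true : evalLit φ y ≡ true
    y-true = satClause-unit (subst (SatClause φ) Fiy (sat iy (inj₂ (inj₁ (≡⇒≈ᶜ Fiy)))))
    P-true : All (λ u → evalLit φ u ≡ true) _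
    P-true = walkIn-true (λ i c → sat i (inj₂ (inj₂ c))) (walk-uses-ArcClause w) x-true

  cut-satisfies-FP : ∀ {x y P} i T Fl → T ++ Fl ≡ P → Unique P → Regular P →
    (∀ j → lookup F j ≈ᶜ (x ∷ []) → j ≢ i → x ∈ˡ T) →
    (∀ j → lookup F j ≈ᶜ (y ∷ []) → j ≢ i → compl y ∈ˡ Fl) →
    (∀ j {c d} → Consec P c d → lookup F j ≈ᶜ CLarc c d → j ≢ i → d ∈ˡ T ⊎ c ∈ˡ Fl) →
    Satisfiable F (FP F x y P ─ i)
  cut-satisfies-FP {x} {y} i T Fl split unique regular on-x on-y on-arc = cut T Fl , sat
    where
    true-on-T : ∀ {u} → u ∈ˡ T → evalLit (cut T Fl) u ≡ true
    true-on-T = cut-true-on-T split unique regular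
    false-on-Fl : ∀ {u} → u ∈ˡ Fl → evalLit (cut T Fl) u ≡ false
    false-on-Fl = cut-false-on-Fl split unique regular
    sat : ∀ j → (FP F x y _ ─ i) j → SatClause (cut T Fl) (lookup F j)
    sat j (inj₁ eq , j≢i) = lose (proj₂ eq (here refl)) (true-on-T (on-x j eq j≢i))
    sat j (inj₂ (inj₁ eq) , j≢i) =
      lose (proj₂ eq (here refl)) (compl-false⇒true _ y (false-on-Fl (on-y j eq j≢i)))
    sat j (inj₂ (inj₂ (c , d , cd , eq)) , j≢i) with on-arc j cd eq j≢i
    ... | inj₁ d∈T = lose (proj₂ eq (there (here refl))) (true-on-T d∈T)
    ... | inj₂ c∈Fl = lose (proj₂ eq (here refl)) (false⇒compl-true _ c (false-on-Fl c∈Fl))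

  regularPath-determined : ∀ {s t P Q} → RegPath F s t P → RegPath F s t Q →
    ArcClauses⊆ P Q → P ≡ Q
  regularPath-determined (here s , _) (here s , _) _ = refl
  regularPath-determined (here s , _) (step _ w , (s∉ ∷ _) , _) _ =
    ⊥-elim (All.lookup s∉ (walk-end-∈ w) refl)
  regularPath-determined (step _ w , (s∉ ∷ _) , _) (here _ , _) _ =
    ⊥-elim (All.lookup s∉ (walk-end-∈ w) refl)
  regularPath-determined (step _ w , uP@(_ ∷ uP′) , regP) (step _ w′ , uQ@(_ ∷ uQ′) , regQ) H
    with consec-head-unique uQ (ArcClauses⊆-consec regP regQ (here refl) H (consec-head w))
  ... | _ , refl with walk-head w′
  ...   | refl = cong (_ ∷_)
      (regularPath-determined (w , uP′ , regular-tail regP) (w′ , uQ′ , regular-tail regQ)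
        (ArcClauses⊆-tail uP regP H))

  arcClause-∈-FP : ∀ {x y P Q a b i} → Regular P → Consec P a b →
    CLarc a b ≈ᶜ lookup F i → FP F x y Q i →
    ∃[ c ] ∃[ d ] (Consec Q c d × CLarc a b ≈ᶜ CLarc c d)
  arcClause-∈-FP reg ab ab≈Fi (inj₁ Fi≈x) =
    ⊥-elim (regular-consec reg ab (CLarc≈unit (≈ᶜ-trans ab≈Fi Fi≈x)))
  arcClause-∈-FP reg ab ab≈Fi (inj₂ (inj₁ Fi≈y)) =
    ⊥-elim (regular-consec reg ab (CLarc≈unit (≈ᶜ-trans ab≈Fi Fi≈y)))
  arcClause-∈-FP reg ab ab≈Fi (inj₂ (inj₂ (c , d , cd , Fi≈cd))) =
    c , d , cd , ≈ᶜ-trans ab≈Fi Fi≈cd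

  FP-injective : ∀ {x y P Q} → RegPath F x (compl y) P → RegPath F x (compl y) Q →
    (∀ i → FP F x y P i ⇔ FP F x y Q i) → P ≡ Q
  FP-injective {P = P} regP@(w , _ , reg) regQ FP⇔ = regularPath-determined regP regQ arcs⊆
    where
    arcs⊆ : ArcClauses⊆ P _
    arcs⊆ ab with walkIn-consec-arc (walk-uses-ArcClause w) ab
    ... | e , e∈CL = arcClause-∈-FP reg ab (≈ᶜ-sym (clauseOf-≈ e))
                       (Equivalence.to (FP⇔ (clauseOf e)) (inj₂ (inj₂ e∈CL)))

  -- Deciding reachability

  successors-sound : ∀ {a c} j → c ∈ˡ successors a (lookup F j) →
    Σ (Arc F a c) (λ e → clauseOf e ≡ j)
  successors-sound {a} j m with lookup F j in eq
  ... | p ∷ [] with ∈-onlyIf (a ≟ᴸ compl p) m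
  ...   | refl , refl = unit j p eq , refl
  successors-sound {a} j m | p ∷ q ∷ [] with ∈-++⁻ (onlyIf (a ≟ᴸ compl p) q) m
  ... | inj₁ m₁ with ∈-onlyIf (a ≟ᴸ compl p) m₁
  ...   | refl , refl = bin₁ j p q eq , refl
  successors-sound {a} j m | p ∷ q ∷ [] | inj₂ m₂ with ∈-onlyIf (a ≟ᴸ compl q) m₂
  ... | refl , refl = bin₂ j p q eq , refl

  successors-complete : ∀ {a c} (e : Arc F a c) → c ∈ˡ successors a (lookup F (clauseOf e))
  successors-complete (bin₁ i a b eq) rewrite eq = ∈-++⁺ˡ (onlyIf-refl (compl a) b)
  successors-complete (bin₂ i a b eq) rewrite eq =
    ∈-++⁺ʳ (onlyIf (compl b ≟ᴸ compl a) b) (onlyIf-refl (compl b) a)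
  successors-complete (unit i a eq) rewrite eq = onlyIf-refl (compl a) a

  walkIn-vertices : ∀ {G a t vs} → WalkIn G a t vs → vs ⊆ a ∷ literals F
  walkIn-vertices (here a) (here eq) = here eq
  walkIn-vertices (step e g w) (here eq) = here eq
  walkIn-vertices (step e g w) (there m) with walkIn-vertices w m
  ... | here refl =
    there (lookup⊆literals F (clauseOf e) (proj₂ (clauseOf-≈ e) (there (here refl))))
  ... | there m′ = there m′

  module _ {G : SubCS n} (G? : ∀ i → Dec (G i)) where

    search : ∀ L a t → Dec (∃[ vs ] (WalkIn G a t vs × length vs ≤ L))
    search zero a t = no λ { (_ , here _ , ()) ; (_ , step _ _ _ , ()) }
    search (suc L) a t with a ≟ᴸ t
    ... | yes refl = yes (_ , here a , s≤s z≤n)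
    ... | no a≢t
      with any? (λ j → G? j ×-dec Any.any? (λ c → search L c t) (successors a (lookup F j)))
    ...   | yes (j , g , found) with find found
    ...     | c , c∈ , (vs , w , ≤L) with successors-sound j c∈
    ...       | e , refl = yes (_ , step e g w , s≤s ≤L)
    search (suc L) a t | no a≢t | no none = no λ
      { (_ , here _ , _) → a≢t refl
      ; (_ , step e g w , s≤s ≤L) →
          none (clauseOf e , g , lose (successors-complete e) (_ , w , ≤L)) }

    -- A shortest walk has distinct vertices, so at most 1 + |literals F| of them.
    reachable? : ∀ a t → Dec (Reachable G a t)
    reachable? a t with search (suc (length (literals F))) a t
    ... | yes (vs , w , _) = yes (vs , w)
    ... | no none = no λ (_ , w) → let (ws , w′ , u) = shortcut w in
      none (ws , w′ , unique-length-≤ ws (a ∷ literals F) u (walkIn-vertices w′))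

  -- Satisfying 2-clauses by the literals reachable from a unit clause

  module _ {G : SubCS n} (G? : ∀ i → Dec (G i))
           (short : ∀ i → G i → (length (lookup F i) ≡ 1) ⊎ (length (lookup F i) ≡ 2))
           {x k} (Fk : lookup F k ≡ x ∷ []) where

    reach-closed : ∀ {i l} → G i → l ∈ˡ lookup F i → Reachable G x (compl l) →
      Any (Reachable G x) (lookup F i)
    reach-closed {i} g m (_ , w) with lookup F i in eq | short i g
    ... | p ∷ [] | _ with m
    ...   | here refl = here (walkIn-snoc w (unit i p eq) g)
    reach-closed {i} g m (_ , w) | p ∷ q ∷ [] | _ with m
    ... | here refl = there (here (walkIn-snoc w (bin₁ i p q eq) g))
    ... | there (here refl) = here (walkIn-snoc w (bin₂ i p q eq) g)
    reach-closed g m _ | _ ∷ _ ∷ _ ∷ _ | inj₁ ()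
    reach-closed g m _ | _ ∷ _ ∷ _ ∷ _ | inj₂ ()

    extend : Assignment → Assignment
    extend φ v with reachable? G? x (pos v) | reachable? G? x (neg v)
    ... | yes _ | _ = true
    ... | no _ | yes _ = false
    ... | no _ | no _ = φ v

    module _ (consistent : Consistent (Reachable G x)) (φ : Assignment) where

      extend-reachable : ∀ l → Reachable G x l → evalLit (extend φ) l ≡ true
      extend-reachable (pos v) r with reachable? G? x (pos v) | reachable? G? x (neg v)
      ... | yes _ | _ = refl
      ... | no ¬r | _ = ⊥-elim (¬r r)
      extend-reachable (neg v) r with reachable? G? x (pos v) | reachable? G? x (neg v)
      ... | yes r̄ | _ = ⊥-elim (consistent (pos v) r̄ r)
      ... | no _ | yes _ = refl
      ... | no _ | no ¬r = ⊥-elim (¬r r)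

      extend-unreachable : ∀ l → ¬ Reachable G x l → ¬ Reachable G x (compl l) →
        evalLit (extend φ) l ≡ evalLit φ l
      extend-unreachable (pos v) ¬r ¬r̄ with reachable? G? x (pos v) | reachable? G? x (neg v)
      ... | yes r | _ = ⊥-elim (¬r r)
      ... | no _ | yes r̄ = ⊥-elim (¬r̄ r̄)
      ... | no _ | no _ = refl
      extend-unreachable (neg v) ¬r ¬r̄ with reachable? G? x (pos v) | reachable? G? x (neg v)
      ... | yes r̄ | _ = ⊥-elim (¬r̄ r̄)
      ... | no _ | yes r = ⊥-elim (¬r r)
      ... | no _ | no _ = refl

    -- A clause with a reachable literal is satisfied by it. Otherwise, by reach-closed, no
    -- complement of its literals is reachable either, so extend φ agrees with φ on it; and it
    -- is not {x}, so φ satisfies it.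
    satisfiable-if-reach-consistent : Consistent (Reachable G x) →
      Satisfiable F (G ─ k) → Satisfiable F G
    satisfiable-if-reach-consistent consistent (φ , φ-sat) = extend φ , sat
      where
      sat : ∀ i → G i → SatClause (extend φ) (lookup F i)
      sat i g with Any.any? (reachable? G? x) (lookup F i)
      ... | yes some with find some
      ...   | l , m , r = lose m (extend-reachable consistent φ l r)
      sat i g | no none = satClause-agree agree (φ-sat i (g , i≢k))
        where
        agree : ∀ {l} → l ∈ˡ lookup F i → evalLit (extend φ) l ≡ evalLit φ l
        agree {l} m = extend-unreachable consistent φ l (none ∘ lose m) (none ∘ reach-closed g m)
        i≢k : i ≢ k
        i≢k refl = none (lose (subst (x ∈ˡ_) (sym Fk) (here refl)) (_ , here x))

  module _ {G : SubCS n} {φ x y iy} (Fiy : lookup F iy ≡ y ∷ [])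
           (φ-sat : ∀ j → (G ─ iy) j → SatClause φ (lookup F j))
           (x-true : evalLit φ x ≡ true) where

    reach-consistent : ¬ Reachable G x (compl y) → Consistent (Reachable G x)
    reach-consistent no-path l r r̄ =
      true-and-compl-true⇒⊥ φ l (reachable-true r) (reachable-true r̄)
      where
      reachable-true : ∀ {l} → Reachable G x l → evalLit φ l ≡ true
      reachable-true (_ , w) with walkIn-avoid-unit Fiy w
      ... | inj₁ w′ = All.lookup (walkIn-true φ-sat w′ x-true) (walk-end-∈ (toWalk w′))
      ... | inj₂ path = ⊥-elim (no-path path)

    unique-walkIn-regular : ∀ {vs} → WalkIn G x (compl y) vs → Unique vs → Regular vs
    unique-walkIn-regular w unique u m m̄ =
      true-and-compl-true⇒⊥ φ u (All.lookup vs-true m) (All.lookup vs-true m̄)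
      where
      vs-true : All (λ u → evalLit φ u ≡ true) _
      vs-true = walkIn-true φ-sat (unique-walkIn-avoid-unit Fiy w unique) x-true

  -- Minimally unsatisfiable subsets and regular paths

  module _ (distinct : ∀ i j → lookup F i ≈ᶜ lookup F j → i ≡ j) where

    same-index : ∀ {i j C} → lookup F i ≈ᶜ C → lookup F j ≈ᶜ C → i ≡ j
    same-index Fi≈C Fj≈C = distinct _ _ (≈ᶜ-trans Fi≈C (≈ᶜ-sym Fj≈C))

    FP-minUnsat : ∀ {x y ix iy P} → lookup F ix ≡ x ∷ [] → lookup F iy ≡ y ∷ [] →
      RegPath F x (compl y) P → MinUnsat F (FP F x y P)
    FP-minUnsat {x} {y} {ix} {iy} {P} Fix Fiy (w , unique , regular) =
      FP-unsat Fix Fiy w , removal-satisfiable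
      where
      removal-satisfiable : ∀ i → FP F x y P i → Satisfiable F (FP F x y P ─ i)
      removal-satisfiable i (inj₁ Fi≈x) =
        cut-satisfies-FP i [] P refl unique regular
          (λ j Fj≈x j≢i → ⊥-elim (j≢i (same-index Fj≈x Fi≈x)))
          (λ _ _ _ → walk-end-∈ w)
          (λ _ cd _ _ → inj₂ (consec-∈ˡ cd))
      removal-satisfiable i (inj₂ (inj₁ Fi≈y)) =
        cut-satisfies-FP i P [] (++-identityʳ P) unique regular
          (λ _ _ _ → walk-start-∈ w)
          (λ j Fj≈y j≢i → ⊥-elim (j≢i (same-index Fj≈y Fi≈y)))
          (λ _ cd _ _ → inj₁ (consec-∈ʳ cd))
      removal-satisfiable i (inj₂ (inj₂ (a , b , ab , Fi≈ab))) with consec-split ab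
      ... | pre , post , P≡ =
        cut-satisfies-FP i (pre ++ a ∷ []) (b ∷ post) split unique regular
          (λ _ _ _ → walk-start-∈-++ pre (subst (Walk F x (compl y)) P≡ w))
          (λ _ _ _ → walk-end-∈-++ (pre ++ a ∷ []) (subst (Walk F x (compl y)) (sym split) w))
          other-arc
        where
        split : (pre ++ a ∷ []) ++ b ∷ post ≡ P
        split = trans (++-assoc pre (a ∷ []) (b ∷ post)) (sym P≡)
        other-arc : ∀ j {c d} → Consec P c d → lookup F j ≈ᶜ CLarc c d → j ≢ i →
          d ∈ˡ pre ++ a ∷ [] ⊎ c ∈ˡ b ∷ post
        other-arc j cd Fj≈cd j≢i with consec-++ pre (subst (λ vs → Consec vs _ _) P≡ cd)
        ... | inj₁ (refl , refl) = ⊥-elim (j≢i (same-index Fj≈cd Fi≈ab))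
        ... | inj₂ before-or-after = before-or-after

    FP-⊆ : ∀ {G : SubCS n} {x y ix iy P} → lookup F ix ≡ x ∷ [] → lookup F iy ≡ y ∷ [] →
      WalkIn G x (compl y) P → G ix → G iy → ∀ i → FP F x y P i → G i
    FP-⊆ {G} Fix _ _ gx _ i (inj₁ Fi≈x) = subst G (sym (same-index Fi≈x (≡⇒≈ᶜ Fix))) gx
    FP-⊆ {G} _ Fiy _ _ gy i (inj₂ (inj₁ Fi≈y)) = subst G (sym (same-index Fi≈y (≡⇒≈ᶜ Fiy))) gy
    FP-⊆ {G} _ _ w _ _ i (inj₂ (inj₂ (a , b , ab , Fi≈ab))) with walkIn-consec-arc w ab
    ... | e , ge = subst G (sym (same-index Fi≈ab (clauseOf-≈ e))) ge

    FP-surjective : ∀ {x y ix iy} →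
      (∀ i → (length (lookup F i) ≡ 1) ⊎ (length (lookup F i) ≡ 2)) →
      lookup F ix ≡ x ∷ [] → lookup F iy ≡ y ∷ [] → x ≢ y →
      ∀ (S : Subset n) → MinUnsat F (_∈ S) → ix ∈ S → iy ∈ S →
      ∃[ P ] (RegPath F x (compl y) P × (∀ i → FP F x y P i ⇔ i ∈ S))
    FP-surjective {x} {y} {ix} {iy} short Fix Fiy x≢y S minUnsat@(S-unsat , S─-sat) ix∈S iy∈S
      with S─-sat iy iy∈S
    ... | φ , φ-sat = from-path (reachable? (_∈? S) x (compl y))
      where
      ix≢iy : ix ≢ iy
      ix≢iy refl = x≢y (∷-injectiveˡ (trans (sym Fix) Fiy))

      x-true : evalLit φ x ≡ true
      x-true = satClause-unit (subst (SatClause φ) Fix (φ-sat ix (ix∈S , ix≢iy)))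

      from-path : Dec (Reachable (_∈ S) x (compl y)) →
        ∃[ P ] (RegPath F x (compl y) P × (∀ i → FP F x y P i ⇔ i ∈ S))
      from-path (no no-path) =
        ⊥-elim (S-unsat (satisfiable-if-reach-consistent (_∈? S) (λ i _ → short i) Fix
          (reach-consistent Fiy φ-sat x-true no-path) (S─-sat ix ix∈S)))
      from-path (yes (_ , w)) with shortcut w
      ... | P , w′ , unique =
        P , (toWalk w′ , unique , unique-walkIn-regular Fiy φ-sat x-true w′ unique) ,
        λ i → mk⇔ (FP⊆S i) (S⊆FP i)
        where
        FP⊆S : ∀ i → FP F x y P i → i ∈ S
        FP⊆S = FP-⊆ Fix Fiy w′ ix∈S iy∈S
        S⊆FP : ∀ i → i ∈ S → FP F x y P i
        S⊆FP = minUnsat-⊇-unsat {F = F} minUnsat FP⊆S (FP-unsat Fix Fiy (toWalk w′)) (FP? x y P)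

theorem6p1 : ∀ {n} (F : Vec Clause n) → WFClauseSet F →
    (∀ i → (length (lookup F i) ≡ 1) ⊎ (length (lookup F i) ≡ 2)) →
    (x y : Lit) (ix iy : Fin n) →
    lookup F ix ≡ x ∷ [] → lookup F iy ≡ y ∷ [] → x ≢ y →
    ((∀ P → RegPath F x (compl y) P →
        MinUnsat F (FP F x y P) × FP F x y P ix × FP F x y P iy)
    × (∀ P Q → RegPath F x (compl y) P → RegPath F x (compl y) Q →
        (∀ i → FP F x y P i ⇔ FP F x y Q i) → P ≡ Q)
    × (∀ (S : Subset n) → MinUnsat F (λ i → i ∈ S) → ix ∈ S → iy ∈ S →
        ∃[ P ] (RegPath F x (compl y) P × (∀ i → FP F x y P i ⇔ i ∈ S))))
theorem6p1 F (_ , distinct) short x y ix iy Fix Fiy x≢y =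
  (λ P regP → FP-minUnsat F distinct Fix Fiy regP , inj₁ (≡⇒≈ᶜ Fix) , inj₂ (inj₁ (≡⇒≈ᶜ Fiy)))
  , (λ P Q → FP-injective F)
  , FP-surjective F distinct short Fix Fiy x≢y
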